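{- Let $p$ be an odd prime and $q$ a power of $p$. Then in the formal power series ring $\mathbb{F}_q[x][[z]]$, $$\sum_{n=0}^{\infty}F_n(1,x)\,z^n=\frac{z}{1-z+xz^2}.$$
   Context: For an integer $n\ge 1$, the $n$-th reversed Dickson polynomial of the third kind is $F_n(a,x)=\sum_{i=0}^{\lfloor n/2\rfloor}\frac{n-2i}{n-i}\binom{n-i}{i}(-x)^i a^{n-2i}$, where the coefficients $\frac{n-2i}{n-i}\binom{n-i}{i}=\binom{n-i}{i}-\binom{n-i-1}{i-1}$ (with $\binom{m}{ -1}=0$) are integers, read in $\mathbb{F}_q$; and $F_0(a,x)=0$. -}

module Defs where

open import Level using (_⊔_)
open import Data.Nat as ℕ using (ℕ; zero; suc; _∸_; _≤ᵇ_)
open import Data.Nat.Combinatorics using (_C_)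
open import Data.Bool using (if_then_else_)
open import Data.Fin using (Fin)
open import Data.Product using (∃; _×_)
open import Algebra.Bundles using (CommutativeRing; Semiring)
open import Function.Bundles using (Inverse)
import Relation.Binary.PropositionalEquality as P
open import Relation.Nullary using (¬_)

module _ {c ℓ} (R : CommutativeRing c ℓ) where
  open CommutativeRing R
  open import Algebra.Definitions.RawSemiring (Semiring.rawSemiring semiring)
    renaming (_×_ to _·_) using (_^_)

  IsField : Set (c ⊔ ℓ)
  IsField = (¬ (1# ≈ 0#)) × (∀ a → ¬ (a ≈ 0#) → ∃ λ b → (a * b) ≈ 1#)

  HasSize : ℕ → Set (c ⊔ ℓ)
  HasSize q = Inverse (P.setoid (Fin q)) setoid

  -- Elements of R[x][[z]] are represented by their coefficient arrays:
  -- S n i = coefficient of z^n x^i.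
  Series : Set c
  Series = ℕ → ℕ → Carrier

  sumLe : ℕ → (ℕ → Carrier) → Carrier
  sumLe zero f = f 0
  sumLe (suc n) f = sumLe n f + f (suc n)

  mulS : Series → Series → Series
  mulS A B n i = sumLe n λ k → sumLe i λ j → A k j * B (n ∸ k) (i ∸ j)

  dcoef : ℕ → ℕ → Carrier
  dcoef n zero = (n C 0) · 1#
  dcoef n (suc i) = ((n ∸ suc i) C suc i) · 1# - ((n ∸ suc i ∸ 1) C i) · 1#

  -- coefficient of x^i in F_n(1,x) = Σ_{i ≤ n/2} ((n-2i)/(n-i)) binom(n-i,i) (-x)^i ; F_0 = 0
  Fcoef : ℕ → ℕ → Carrier
  Fcoef zero i = 0#
  Fcoef (suc m) i =
    if (i ℕ.+ i) ≤ᵇ suc m then ((- 1#) ^ i) * dcoef (suc m) i else 0#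

  FSeries : Series
  FSeries n i = Fcoef n i

  DSeries : Series
  DSeries 0 0 = 1#
  DSeries 1 0 = - 1#
  DSeries 2 1 = 1#
  DSeries _ _ = 0#

  ZSeries : Series
  ZSeries 1 0 = 1#
  ZSeries _ _ = 0#

{-# OPTIONS --safe #-}
-- Pascal's rule turns the coefficient C(n−i,i) − C(n−i−1,i−1) into C(n−1−i,i), so
-- F_{m+1}(1,x) = Σ_i C(m−i,i) (−x)^i, and Pascal's rule once more gives the recurrence
-- F_0 = 0, F_1 = 1, F_{m+2} = F_{m+1} − x F_m.  Multiplying any series whose coefficients
-- obey this recurrence by 1 − z + x z² cancels everything except z.  This works over every
-- commutative ring.
module Submission where

open import Defs
open import Data.Nat using (ℕ; _^_; _≥_)
open import Data.Nat.Primality using (Prime)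
open import Data.Product using (∃; _×_)
open import Relation.Binary.PropositionalEquality using (_≡_; _≢_)
open import Algebra.Bundles using (CommutativeRing; Semiring)

open import Level using (_⊔_)
open import Data.Nat as ℕ using (zero; suc; _∸_; _≤_; _<_; _≤ᵇ_; z≤n; z<s; s≤s; _≤?_)
open import Data.Nat.Properties
  using (≤-refl; ≤-trans; <⇒≤; ≤-<-trans; ≰⇒>; m≤n⇒m≤1+n; m≤n+m; m∸n≤m;
         m∸[m∸n]≡n; m≤n⇒m∸n≡0; +-∸-assoc; m<n+o⇒m∸n<o; ≤ᵇ-reflects-≤)
import Data.Nat.Properties as ℕₚ
open import Data.Nat.Combinatorics using (_C_; k>n⇒nCk≡0; nCk+nC[k+1]≡[n+1]C[k+1])
open import Data.Bool using (true; false)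
open import Relation.Nullary using (yes; no; ofʸ; ofⁿ)
import Relation.Binary.PropositionalEquality as ≡

m<n+n⇒m∸n<n : ∀ m n → m < n ℕ.+ n → m ∸ n < n
m<n+n⇒m∸n<n m (suc n) = m<n+o⇒m∸n<o m (suc n)

n+n≤1+m⇒n≤m : ∀ {m} n → n ℕ.+ n ≤ suc m → n ≤ m
n+n≤1+m⇒n≤m zero    _       = z≤n
n+n≤1+m⇒n≤m (suc n) (s≤s p) = ≤-trans (m≤n+m (suc n) n) p

[1+m∸n]C[1+n] : ∀ m n → (suc m ∸ n) C suc n ≡ (m ∸ n) C suc n ℕ.+ (m ∸ n) C n
[1+m∸n]C[1+n] m n with n ≤? m
... | yes n≤m rewrite +-∸-assoc 1 n≤m =
  ≡.trans (≡.sym (nCk+nC[k+1]≡[n+1]C[k+1] (m ∸ n) n)) (ℕₚ.+-comm ((m ∸ n) C n) _)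
-- For n > m both sides are binomials 0 C k with k ≥ 1.
... | no n≰m with ≰⇒> n≰m
...   | m<n@(s≤s _) rewrite m≤n⇒m∸n≡0 m<n | m≤n⇒m∸n≡0 (<⇒≤ m<n) = ≡.refl

module _ {c ℓ} (R : CommutativeRing c ℓ) where
  open CommutativeRing R
  open import Algebra.Definitions.RawSemiring (Semiring.rawSemiring semiring)
    renaming (_×_ to _·_; _^_ to _^ʳ_)
  open import Algebra.Properties.Ring ring using (-1*x≈-x)
  open import Algebra.Properties.Group +-group using (ε⁻¹≈ε; x≈y⇒x∙y⁻¹≈ε)
  open import Algebra.Properties.AbelianGroup +-abelianGroup using (xyx⁻¹≈y; ⁻¹-anti-homo‿-)
  open import Algebra.Properties.Semiring.Mult semiring using (×-congˡ; ×-homo-+)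
  open import Relation.Binary.Reasoning.Setoid setoid

  x-0#≈x : ∀ x → x - 0# ≈ x
  x-0#≈x x = trans (+-congˡ ε⁻¹≈ε) (+-identityʳ x)

  x≈y-z⇒x+[-y+z]≈0# : ∀ {x y z} → x ≈ y - z → x + (- y + z) ≈ 0#
  x≈y-z⇒x+[-y+z]≈0# {x} {y} {z} x≈y-z = begin
    x + (- y + z)   ≈⟨ +-congˡ (+-comm (- y) z) ⟩
    x + (z - y)     ≈⟨ +-congˡ (sym (⁻¹-anti-homo‿- y z)) ⟩
    x - (y - z)     ≈⟨ x≈y⇒x∙y⁻¹≈ε x≈y-z ⟩
    0#              ∎

  sumLe-cong : ∀ n {f g : ℕ → Carrier} → (∀ k → k ≤ n → f k ≈ g k) →
               sumLe R n f ≈ sumLe R n g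
  sumLe-cong zero    f≈g = f≈g 0 z≤n
  sumLe-cong (suc n) f≈g =
    +-cong (sumLe-cong n (λ k k≤n → f≈g k (m≤n⇒m≤1+n k≤n))) (f≈g (suc n) ≤-refl)

  sumLe-suc : ∀ n f → sumLe R (suc n) f ≈ f 0 + sumLe R n (λ k → f (suc k))
  sumLe-suc zero    f = refl
  sumLe-suc (suc n) f = trans (+-congʳ (sumLe-suc n f)) (+-assoc _ _ _)

  sumLe-head : ∀ n f → (∀ k → f (suc k) ≈ 0#) → sumLe R n f ≈ f 0
  sumLe-head zero    f tail≈0 = refl
  sumLe-head (suc n) f tail≈0 =
    trans (+-cong (sumLe-head n f tail≈0) (tail≈0 n)) (+-identityʳ _)

  sumLe-zero : ∀ n f → (∀ k → f k ≈ 0#) → sumLe R n f ≈ 0#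
  sumLe-zero n f f≈0 = trans (sumLe-head n f (λ k → f≈0 (suc k))) (f≈0 0)

  sumLe-reverse : ∀ n f → sumLe R n f ≈ sumLe R n (λ k → f (n ∸ k))
  sumLe-reverse zero    f = refl
  sumLe-reverse (suc n) f = begin
    sumLe R n f + f (suc n)                   ≈⟨ +-congʳ (sumLe-reverse n f) ⟩
    sumLe R n (λ k → f (n ∸ k)) + f (suc n)   ≈⟨ +-comm _ _ ⟩
    f (suc n) + sumLe R n (λ k → f (n ∸ k))   ≈⟨ sumLe-suc n (λ k → f (suc n ∸ k)) ⟨
    sumLe R (suc n) (λ k → f (suc n ∸ k))     ∎

  sumLe-reverse₂ : ∀ n (h : ℕ → ℕ → Carrier) →
                   sumLe R n (λ k → h k (n ∸ k)) ≈ sumLe R n (λ k → h (n ∸ k) k)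
  sumLe-reverse₂ n h = trans (sumLe-reverse n _)
    (sumLe-cong n (λ k k≤n → reflexive (≡.cong (h (n ∸ k)) (m∸[m∸n]≡n k≤n))))

  mulS-reversed : ∀ A B n i →
    mulS R A B n i ≈ sumLe R n (λ k → sumLe R i (λ j → A (n ∸ k) (i ∸ j) * B k j))
  mulS-reversed A B n i =
    trans (sumLe-reverse₂ n (λ k d → sumLe R i (λ j → A k j * B d (i ∸ j))))
          (sumLe-cong n (λ k _ → sumLe-reverse₂ i (λ j e → A (n ∸ k) j * B k e)))

  mulX : (ℕ → Carrier) → ℕ → Carrier
  mulX f zero    = 0#
  mulX f (suc i) = f i

  record FibonacciRecurrence (A : Series R) : Set (c ⊔ ℓ) where
    field
      initial₀ : ∀ i → A 0 i ≈ 0#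
      initial₁ : ∀ i → A 1 i ≈ ZSeries R 1 i
      step     : ∀ m i → A (suc (suc m)) i ≈ A (suc m) i - mulX (A m) i

  module _ (A : Series R) where

    column : ℕ → ℕ → ℕ → Carrier
    column n i k = sumLe R i (λ j → A (n ∸ k) (i ∸ j) * DSeries R k j)

    column-0 : ∀ n i → column n i 0 ≈ A n i
    column-0 n i = trans (sumLe-head i _ (λ _ → zeroʳ _)) (*-identityʳ _)

    column-1 : ∀ n i → column n i 1 ≈ - A (n ∸ 1) i
    column-1 n i =
      trans (sumLe-head i _ (λ _ → zeroʳ _)) (trans (*-comm _ _) (-1*x≈-x _))

    column-2 : ∀ n i → column n i 2 ≈ mulX (A (n ∸ 2)) i
    column-2 n zero    = zeroʳ _
    column-2 n (suc i) = begin
      column n (suc i) 2                                                 ≈⟨ sumLe-suc i _ ⟩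
      A (n ∸ 2) (suc i) * 0# + sumLe R i (λ j → A (n ∸ 2) (i ∸ j) * DSeries R 2 (suc j))
        ≈⟨ +-cong (zeroʳ _) (sumLe-head i _ (λ _ → zeroʳ _)) ⟩
      0# + A (n ∸ 2) i * 1#                                              ≈⟨ +-identityˡ _ ⟩
      A (n ∸ 2) i * 1#                                                   ≈⟨ *-identityʳ _ ⟩
      A (n ∸ 2) i                                                        ∎

    column-3+ : ∀ n i k → column n i (3 ℕ.+ k) ≈ 0#
    column-3+ n i k = sumLe-zero i _ (λ _ → zeroʳ _)

  mulS-DSeries≈ZSeries : ∀ {A} → FibonacciRecurrence A →
                         ∀ n i → mulS R A (DSeries R) n i ≈ ZSeries R n i
  mulS-DSeries≈ZSeries {A} rec zero i = begin
    mulS R A (DSeries R) 0 i  ≈⟨ mulS-reversed A (DSeries R) 0 i ⟩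
    column A 0 i 0            ≈⟨ column-0 A 0 i ⟩
    A 0 i                     ≈⟨ initial₀ i ⟩
    0#                        ∎
    where open FibonacciRecurrence rec
  mulS-DSeries≈ZSeries {A} rec (suc zero) i = begin
    mulS R A (DSeries R) 1 i         ≈⟨ mulS-reversed A (DSeries R) 1 i ⟩
    column A 1 i 0 + column A 1 i 1  ≈⟨ +-cong (column-0 A 1 i) (column-1 A 1 i) ⟩
    A 1 i - A 0 i                    ≈⟨ +-congˡ (-‿cong (initial₀ i)) ⟩
    A 1 i - 0#                       ≈⟨ x-0#≈x _ ⟩
    A 1 i                            ≈⟨ initial₁ i ⟩
    ZSeries R 1 i                    ∎
    where open FibonacciRecurrence rec
  mulS-DSeries≈ZSeries {A} rec (suc (suc m)) i = begin
    mulS R A (DSeries R) n i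
      ≈⟨ mulS-reversed A (DSeries R) n i ⟩
    sumLe R n (column A n i)                                       ≈⟨ sumLe-suc (suc m) _ ⟩
    column A n i 0 + sumLe R (suc m) (λ k → column A n i (suc k))  ≈⟨ +-congˡ (sumLe-suc m _) ⟩
    column A n i 0 + (column A n i 1 + sumLe R m (λ k → column A n i (2 ℕ.+ k)))
      ≈⟨ +-congˡ (+-congˡ (sumLe-head m _ (column-3+ A n i))) ⟩
    column A n i 0 + (column A n i 1 + column A n i 2)
      ≈⟨ +-cong (column-0 A n i) (+-cong (column-1 A n i) (column-2 A n i)) ⟩
    A n i + (- A (suc m) i + mulX (A m) i)
      ≈⟨ x≈y-z⇒x+[-y+z]≈0# (step m i) ⟩
    0#                                                             ∎
    where
      open FibonacciRecurrence rec
      n = suc (suc m)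

  fibCoef : ℕ → ℕ → Carrier
  fibCoef m i = (- 1#) ^ʳ i * (((m ∸ i) C i) · 1#)

  fibCoef-0 : ∀ m → fibCoef m 0 ≈ 1#
  fibCoef-0 m = trans (*-identityˡ _) (+-identityʳ 1#)

  fibCoef-vanishes : ∀ m i → m ∸ i < i → fibCoef m i ≈ 0#
  fibCoef-vanishes m i m∸i<i =
    trans (*-congˡ (×-congˡ (k>n⇒nCk≡0 m∸i<i))) (zeroʳ _)

  fibCoef-step : ∀ m i → fibCoef (suc (suc m)) (suc i) ≈ fibCoef (suc m) (suc i) - fibCoef m i
  fibCoef-step m i = begin
    fibCoef (suc (suc m)) (suc i)                    ≡⟨⟩
    (- 1# * s) * (((suc m ∸ i) C suc i) · 1#)        ≈⟨ *-congˡ (×-congˡ ([1+m∸n]C[1+n] m i)) ⟩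
    (- 1# * s) * ((a C suc i ℕ.+ a C i) · 1#)        ≈⟨ *-congˡ (×-homo-+ 1# (a C suc i) (a C i)) ⟩
    (- 1# * s) * ((a C suc i) · 1# + (a C i) · 1#)   ≈⟨ distribˡ _ _ _ ⟩
    (- 1# * s) * ((a C suc i) · 1#) + (- 1# * s) * ((a C i) · 1#)
      ≈⟨ +-congˡ (trans (*-assoc _ _ _) (-1*x≈-x _)) ⟩
    fibCoef (suc m) (suc i) - fibCoef m i            ∎
    where
      s = (- 1#) ^ʳ i
      a = m ∸ i

  dcoef-suc : ∀ {m i} → i ≤ m → dcoef R (suc m) i ≈ ((m ∸ i) C i) · 1#
  dcoef-suc {m}     {zero}  _         = refl
  dcoef-suc {suc m} {suc i} (s≤s i≤m) rewrite +-∸-assoc 1 i≤m = begin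
    (suc a C suc i) · 1# - (a C i) · 1#
      ≈⟨ +-congʳ (×-congˡ (≡.sym (nCk+nC[k+1]≡[n+1]C[k+1] a i))) ⟩
    (a C i ℕ.+ a C suc i) · 1# - (a C i) · 1#           ≈⟨ +-congʳ (×-homo-+ 1# (a C i) (a C suc i)) ⟩
    (a C i) · 1# + (a C suc i) · 1# - (a C i) · 1#      ≈⟨ xyx⁻¹≈y _ _ ⟩
    (a C suc i) · 1#                                    ∎
    where a = m ∸ i

  Fcoef-suc : ∀ m i → Fcoef R (suc m) i ≈ fibCoef m i
  Fcoef-suc m i with i ℕ.+ i ≤ᵇ suc m | ≤ᵇ-reflects-≤ (i ℕ.+ i) (suc m)
  ... | true  | ofʸ 2i≤1+m = *-congˡ (dcoef-suc (n+n≤1+m⇒n≤m i 2i≤1+m))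
  ... | false | ofⁿ 2i≰1+m =
    sym (fibCoef-vanishes m i (m<n+n⇒m∸n<n m i (<⇒≤ (≰⇒> 2i≰1+m))))

  FSeries-fibonacci : FibonacciRecurrence (FSeries R)
  FSeries-fibonacci = record { initial₀ = λ _ → refl ; initial₁ = initial₁ ; step = step }
    where
      initial₁ : ∀ i → Fcoef R 1 i ≈ ZSeries R 1 i
      initial₁ zero    = trans (Fcoef-suc 0 0) (fibCoef-0 0)
      initial₁ (suc i) = trans (Fcoef-suc 0 (suc i)) (fibCoef-vanishes 0 (suc i) z<s)

      step : ∀ m i → Fcoef R (suc (suc m)) i ≈ Fcoef R (suc m) i - mulX (Fcoef R m) i
      step m zero = begin
        Fcoef R (suc (suc m)) 0   ≈⟨ trans (Fcoef-suc (suc m) 0) (fibCoef-0 (suc m)) ⟩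
        1#                        ≈⟨ trans (Fcoef-suc m 0) (fibCoef-0 m) ⟨
        Fcoef R (suc m) 0         ≈⟨ x-0#≈x _ ⟨
        Fcoef R (suc m) 0 - 0#    ∎
      step zero (suc i) = begin
        Fcoef R 2 (suc i)
          ≈⟨ trans (Fcoef-suc 1 (suc i)) (fibCoef-vanishes 1 (suc i) (≤-<-trans (m∸n≤m 0 i) z<s)) ⟩
        0#                        ≈⟨ trans (Fcoef-suc 0 (suc i)) (fibCoef-vanishes 0 (suc i) z<s) ⟨
        Fcoef R 1 (suc i)         ≈⟨ x-0#≈x _ ⟨
        Fcoef R 1 (suc i) - 0#    ∎
      step (suc m) (suc i) = begin
        Fcoef R (suc (suc (suc m))) (suc i)                   ≈⟨ Fcoef-suc (suc (suc m)) (suc i) ⟩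
        fibCoef (suc (suc m)) (suc i)                         ≈⟨ fibCoef-step m i ⟩
        fibCoef (suc m) (suc i) - fibCoef m i
          ≈⟨ +-cong (Fcoef-suc (suc m) (suc i)) (-‿cong (Fcoef-suc m i)) ⟨
        Fcoef R (suc (suc m)) (suc i) - Fcoef R (suc m) i     ∎

theorem2p8 : ∀ {c ℓ} (p q : ℕ) → Prime p → p ≢ 2 → (∃ λ k → k ≥ 1 × q ≡ p ^ k)
             → (R : CommutativeRing c ℓ) → IsField R → HasSize R q
             → ∀ n i → CommutativeRing._≈_ R (mulS R (FSeries R) (DSeries R) n i) (ZSeries R n i)
theorem2p8 _ _ _ _ _ R _ _ = mulS-DSeries≈ZSeries R (FSeries-fibonacci R)
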